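{- Let $P$ be a vertex preorder in $C(m,n)$. The edge preorders $E\in C(m,n)$ with $P\le E$ are in bijection with the edges of the Hasse diagram of the partial order $P$ (i.e. with the covering relations $a<_P b$).
   Context: Fix positive integers $m,n$. $\mathsf{Coll}(m,n)$ is the finite set of formal symbols $m_1,\dots,m_{m-1}$ and $l_1,\dots,l_{n-1}$. A preorder is a reflexive transitive relation $\le$; $x\equiv y$ means $x\le y$ and $y\le x$, $x<y$ means $x\le y$ but not $y\le x$, and $x,y$ are comparable if $x\le y$ or $y\le x$. Pairs $\{m_j,l_i\}$ are orthogonal; pairs $\{m_j,m_{j'}\}$ or $\{l_i,l_{i'}\}$ are parallel. Given a preorder, an orthogonal link between parallel $m_i,m_j$ is an $l_s$ with $m_i\le l_s\le m_j$ or $m_j\le l_s\le m_i$; a gap between $m_i,m_j$ is an $m_s$ with $s$ between $i$ and $j$ inclusive and $m_i<m_s$, $m_j<m_s$; links and gaps between $l_i,l_j$ are defined symmetrically. A preorder is a good rectangular preorder if (1) any two orthogonal collisions are comparable, and (2) two parallel collisions are comparable iff there is an orthogonal link between them or there is no gap between them. $C(m,n)$ is the set of good rectangular preorders ordered by refinement: $P\le Q$ iff $x\le_P y$ implies $x\le_Q y$. A vertex preorder is a good rectangular preorder in which $x\equiv y$ implies $x=y$. An edge preorder is a good rectangular preorder in which exactly one equivalence class has two elements and every other equivalence class has one element. -}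

module Defs where

open import Data.Nat using (ℕ; pred)
open import Data.Fin using (Fin; toℕ)
open import Data.Bool using (Bool; T)
open import Data.Sum using (_⊎_; inj₁; inj₂)
open import Data.Product using (Σ; ∃; ∃-syntax; _×_; _,_; proj₁; proj₂)
open import Data.Empty using (⊥)
open import Relation.Nullary using (¬_)
open import Relation.Binary.PropositionalEquality using (_≡_; _≢_; refl; sym; trans)
open import Relation.Binary.Bundles using (Setoid)
import Data.Nat as N

-- Collisions: mc i is m_{i+1} (i < m-1), lc i is l_{i+1} (i < n-1)
data Coll (m n : ℕ) : Set where
  mc : Fin (pred m) → Coll m n
  lc : Fin (pred n) → Coll m n

Rel : ℕ → ℕ → Set
Rel m n = Coll m n → Coll m n → Bool

module _ {m n : ℕ} (R : Rel m n) where

  _≤R_ : Coll m n → Coll m n → Set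
  x ≤R y = T (R x y)

  _≡R_ : Coll m n → Coll m n → Set
  x ≡R y = x ≤R y × y ≤R x

  _<R_ : Coll m n → Coll m n → Set
  x <R y = x ≤R y × ¬ (y ≤R x)

  Comparable : Coll m n → Coll m n → Set
  Comparable x y = x ≤R y ⊎ y ≤R x

  IsPreorder : Set
  IsPreorder = (∀ x → x ≤R x) × (∀ x y z → x ≤R y → y ≤R z → x ≤R z)

  Between : {k : ℕ} → Fin k → Fin k → Fin k → Set
  Between i s j = (toℕ i N.≤ toℕ s × toℕ s N.≤ toℕ j) ⊎ (toℕ j N.≤ toℕ s × toℕ s N.≤ toℕ i)

  LinkM : Fin (pred m) → Fin (pred m) → Set
  LinkM i j = ∃[ s ] ((mc i ≤R lc s × lc s ≤R mc j) ⊎ (mc j ≤R lc s × lc s ≤R mc i))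

  LinkL : Fin (pred n) → Fin (pred n) → Set
  LinkL i j = ∃[ s ] ((lc i ≤R mc s × mc s ≤R lc j) ⊎ (lc j ≤R mc s × mc s ≤R lc i))

  GapM : Fin (pred m) → Fin (pred m) → Set
  GapM i j = ∃[ s ] (Between i s j × mc i <R mc s × mc j <R mc s)

  GapL : Fin (pred n) → Fin (pred n) → Set
  GapL i j = ∃[ s ] (Between i s j × lc i <R lc s × lc j <R lc s)

  IsGoodRect : Set
  IsGoodRect =
    IsPreorder
    × (∀ i j → Comparable (mc i) (lc j))
    × (∀ i j → (Comparable (mc i) (mc j) → LinkM i j ⊎ ¬ GapM i j)
                × (LinkM i j ⊎ ¬ GapM i j → Comparable (mc i) (mc j)))
    × (∀ i j → (Comparable (lc i) (lc j) → LinkL i j ⊎ ¬ GapL i j)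
                × (LinkL i j ⊎ ¬ GapL i j → Comparable (lc i) (lc j)))

  IsVertex : Set
  IsVertex = IsGoodRect × (∀ x y → x ≡R y → x ≡ y)

  IsEdge : Set
  IsEdge = IsGoodRect × ∃[ a ] ∃[ b ] (a ≢ b × a ≡R b
             × (∀ x y → x ≡R y → x ≡ y ⊎ ((x ≡ a × y ≡ b) ⊎ (x ≡ b × y ≡ a))))

  Covers : Coll m n → Coll m n → Set
  Covers a b = a <R b × ¬ (∃[ c ] (a <R c × c <R b))

_⊑_ : {m n : ℕ} → Rel m n → Rel m n → Set
P ⊑ Q = ∀ x y → _≤R_ P x y → _≤R_ Q x y

CoverSetoid : {m n : ℕ} → Rel m n → Setoid _ _
CoverSetoid {m} {n} P = record
  { Carrier = Σ (Coll m n × Coll m n) (λ p → Covers P (proj₁ p) (proj₂ p))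
  ; _≈_ = λ c d → proj₁ c ≡ proj₁ d
  ; isEquivalence = record { refl = refl ; sym = sym ; trans = trans }
  }

EdgeAboveSetoid : {m n : ℕ} → Rel m n → Setoid _ _
EdgeAboveSetoid {m} {n} P = record
  { Carrier = Σ (Rel m n) (λ E → IsEdge E × P ⊑ E)
  ; _≈_ = λ E F → ∀ x y → proj₁ E x y ≡ proj₁ F x y
  ; isEquivalence = record
      { refl = λ x y → refl
      ; sym = λ e x y → sym (e x y)
      ; trans = λ e f x y → trans (e x y) (f x y) }
  }

-- A cover a ⋖ b of P is sent to the contraction of P along it (P together with b ≤ a,
-- closed transitively), whose only nontrivial class is {a, b}. A transitive refinement E of
-- the good preorder P inherits the link/gap condition on pairs that P compares and on pairs
-- that E leaves incomparable. On a pair only the contraction compares, x ≤ b and a ≤ y: an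
-- orthogonal a or b is a link, and if a and b are parallel the cover forces y = a, and P has
-- no gap from x to b nor from a to b, which leaves no room for a gap from x to a.
-- Conversely, the merged pair {a, b} of an edge preorder E over P is P-comparable (a P-gap
-- over an incomparable pair would survive in E), is a cover, and E is its contraction.

module Submission where

open import Defs
open import Data.Nat using (ℕ; _≤_)
open import Function.Bundles using (Bijection; Equivalence; mk⇔)
open import Function.Definitions using (Congruent; Injective; StrictlySurjective; Bijective)
open import Data.Bool using (true; T; _∧_; _∨_)
open import Data.Bool.Properties using (T-∧; T-∨; T-≡; ⇔→≡)
open import Data.Empty using (⊥; ⊥-elim)
open import Data.Fin using (Fin; toℕ)
open import Data.Fin.Properties using (any?)
import Data.Nat as ℕ
import Data.Nat.Properties as ℕ
open import Data.Product using (∃; _×_; _,_; proj₁; proj₂)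
import Data.Product as Product
open import Data.Sum using (_⊎_; inj₁; inj₂; [_,_]; [_,_]′; swap)
import Data.Sum as Sum
open import Function using (_∘_; id)
open import Relation.Binary.Bundles using (Setoid)
import Function.Consequences.Setoid as Consequences
open import Relation.Nullary using (¬_; Dec; yes; no)
open import Relation.Nullary.Decidable using (T?; ¬?; _×-dec_; _⊎-dec_; decidable-stable)
open import Relation.Binary.PropositionalEquality using (_≡_; _≢_; refl; sym; cong; cong₂; subst)

infix 4 _≤[_]_ _<[_]_ _≈[_]_

_≤[_]_ : ∀ {m n} → Coll m n → Rel m n → Coll m n → Set
x ≤[ R ] y = _≤R_ R x y

_<[_]_ : ∀ {m n} → Coll m n → Rel m n → Coll m n → Set
x <[ R ] y = _<R_ R x y

_≈[_]_ : ∀ {m n} → Coll m n → Rel m n → Coll m n → Set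
x ≈[ R ] y = _≡R_ R x y

T-⇔⇒≡ : ∀ {x y} → (T x → T y) → (T y → T x) → x ≡ y
T-⇔⇒≡ f g = ⇔→≡ {z = true} (mk⇔ (to T-≡ ∘ f ∘ from T-≡) (to T-≡ ∘ g ∘ from T-≡))
  where open Equivalence

comparable? : ∀ {m n} (R : Rel m n) x y → Dec (Comparable R x y)
comparable? R x y = T? (R x y) ⊎-dec T? (R y x)

<? : ∀ {m n} (R : Rel m n) x y → Dec (x <[ R ] y)
<? R x y = T? (R x y) ×-dec ¬? (T? (R y x))

module PreorderProperties {m n : ℕ} {R : Rel m n} (R-pre : IsPreorder R) where

  ≤-refl : ∀ x → x ≤[ R ] x
  ≤-refl = proj₁ R-pre

  ≤-reflexive : ∀ {x y} → x ≡ y → x ≤[ R ] y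
  ≤-reflexive refl = ≤-refl _

  ≤-trans : ∀ {x y z} → x ≤[ R ] y → y ≤[ R ] z → x ≤[ R ] z
  ≤-trans = proj₂ R-pre _ _ _

  ≤-<-trans : ∀ {x y z} → x ≤[ R ] y → y <[ R ] z → x <[ R ] z
  ≤-<-trans x≤y (y≤z , z≰y) = ≤-trans x≤y y≤z , λ z≤x → z≰y (≤-trans z≤x x≤y)

OnlyIdentifies : ∀ {m n} → Rel m n → Coll m n → Coll m n → Set
OnlyIdentifies E a b = ∀ x y → x ≈[ E ] y → x ≡ y ⊎ ((x ≡ a × y ≡ b) ⊎ (x ≡ b × y ≡ a))

OnlyIdentifies-sym : ∀ {m n} {E : Rel m n} {a b} → OnlyIdentifies E a b → OnlyIdentifies E b a
OnlyIdentifies-sym only x y x≈y = Sum.map₂ swap (only x y x≈y)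

OnlyIdentifies-endpoint : ∀ {m n} {E : Rel m n} {a b} → OnlyIdentifies E a b →
                          ∀ {z w} → w ≡ a ⊎ w ≡ b → z ≈[ E ] w → z ≡ a ⊎ z ≡ b
OnlyIdentifies-endpoint only {z} {w} w∈ z≈w with only z w z≈w
... | inj₁ refl = w∈
... | inj₂ (inj₁ (z≡a , _)) = inj₁ z≡a
... | inj₂ (inj₂ (z≡b , _)) = inj₂ z≡b

pair-classes : ∀ {A : Set} {a b x y : A} → x ≡ a ⊎ x ≡ b → y ≡ a ⊎ y ≡ b →
               x ≡ y ⊎ ((x ≡ a × y ≡ b) ⊎ (x ≡ b × y ≡ a))
pair-classes (inj₁ refl) (inj₁ refl) = inj₁ refl
pair-classes (inj₁ refl) (inj₂ refl) = inj₂ (inj₁ (refl , refl))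
pair-classes (inj₂ refl) (inj₁ refl) = inj₂ (inj₂ (refl , refl))
pair-classes (inj₂ refl) (inj₂ refl) = inj₁ refl

_∈⟦_,_⟧ : ℕ → ℕ → ℕ → Set
s ∈⟦ i , j ⟧ = (i ≤ s × s ≤ j) ⊎ (j ≤ s × s ≤ i)

∈⟦⟧? : ∀ s i j → Dec (s ∈⟦ i , j ⟧)
∈⟦⟧? s i j = (i ℕ.≤? s ×-dec s ℕ.≤? j) ⊎-dec (j ℕ.≤? s ×-dec s ℕ.≤? i)

∈⟦⟧-sym : ∀ {s i j} → s ∈⟦ i , j ⟧ → s ∈⟦ j , i ⟧
∈⟦⟧-sym = swap

∈⟦⟧-split : ∀ {s i j} k → s ∈⟦ i , j ⟧ → s ∈⟦ i , k ⟧ ⊎ s ∈⟦ k , j ⟧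
∈⟦⟧-split {s} k s∈ with ℕ.≤-total s k
∈⟦⟧-split k (inj₁ (i≤s , s≤j)) | inj₁ s≤k = inj₁ (inj₁ (i≤s , s≤k))
∈⟦⟧-split k (inj₁ (i≤s , s≤j)) | inj₂ k≤s = inj₂ (inj₁ (k≤s , s≤j))
∈⟦⟧-split k (inj₂ (j≤s , s≤i)) | inj₁ s≤k = inj₂ (inj₂ (j≤s , s≤k))
∈⟦⟧-split k (inj₂ (j≤s , s≤i)) | inj₂ k≤s = inj₁ (inj₂ (k≤s , s≤i))

∈⟦⟧-subinterval : ∀ {s′ s i j} → s′ ∈⟦ j , s ⟧ → s ∈⟦ i , j ⟧ → s′ ∈⟦ i , j ⟧
∈⟦⟧-subinterval (inj₁ (j≤s′ , s′≤s)) (inj₁ (i≤s , s≤j)) =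
  inj₁ (ℕ.≤-trans i≤s (ℕ.≤-trans s≤j j≤s′) , ℕ.≤-trans s′≤s s≤j)
∈⟦⟧-subinterval (inj₂ (s≤s′ , s′≤j)) (inj₁ (i≤s , s≤j)) = inj₁ (ℕ.≤-trans i≤s s≤s′ , s′≤j)
∈⟦⟧-subinterval (inj₁ (j≤s′ , s′≤s)) (inj₂ (j≤s , s≤i)) = inj₂ (j≤s′ , ℕ.≤-trans s′≤s s≤i)
∈⟦⟧-subinterval (inj₂ (s≤s′ , s′≤j)) (inj₂ (j≤s , s≤i)) =
  inj₂ (ℕ.≤-trans j≤s s≤s′ , ℕ.≤-trans s′≤j (ℕ.≤-trans j≤s s≤i))

-- The preorder generated by P and the extra relation b ≤ a.
contract : ∀ {m n} → Rel m n → Coll m n → Coll m n → Rel m n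
contract P a b x y = P x y ∨ (P x b ∧ P a y)

module Contraction {m n : ℕ} {P : Rel m n} (P-pre : IsPreorder P) where

  open PreorderProperties P-pre

  P⊑contract : ∀ {a b} → P ⊑ contract P a b
  P⊑contract x y x≤y = Equivalence.from T-∨ (inj₁ x≤y)

  contract-intro : ∀ {a b x y} → x ≤[ P ] b → a ≤[ P ] y → x ≤[ contract P a b ] y
  contract-intro x≤b a≤y = Equivalence.from T-∨ (inj₂ (Equivalence.from T-∧ (x≤b , a≤y)))

  contract-elim : ∀ a b {x y} → x ≤[ contract P a b ] y → x ≤[ P ] y ⊎ (x ≤[ P ] b × a ≤[ P ] y)
  contract-elim a b x≤y = Sum.map₂ (Equivalence.to T-∧) (Equivalence.to T-∨ x≤y)

  contract-isPreorder : ∀ a b → IsPreorder (contract P a b)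
  contract-isPreorder a b = (λ x → P⊑contract x x (≤-refl x)) , contract-trans
    where
    contract-trans : ∀ x y z → x ≤[ contract P a b ] y → y ≤[ contract P a b ] z → x ≤[ contract P a b ] z
    contract-trans x y z x≤y y≤z with contract-elim a b x≤y | contract-elim a b y≤z
    ... | inj₁ x≤y | inj₁ y≤z = P⊑contract x z (≤-trans x≤y y≤z)
    ... | inj₁ x≤y | inj₂ (y≤b , a≤z) = contract-intro (≤-trans x≤y y≤b) a≤z
    ... | inj₂ (x≤b , a≤y) | inj₁ y≤z = contract-intro x≤b (≤-trans a≤y y≤z)
    ... | inj₂ (x≤b , _) | inj₂ (_ , a≤z) = contract-intro x≤b a≤z

  contract-least : ∀ {a b} {E : Rel m n} → IsPreorder E → P ⊑ E → b ≤[ E ] a → contract P a b ⊑ E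
  contract-least {a} {b} E-pre P⊑E b≤a x y x≤y =
    [ P⊑E x y , (λ { (x≤b , a≤y) → ≤E-trans (P⊑E x b x≤b) (≤E-trans b≤a (P⊑E a y a≤y)) }) ]
      (contract-elim a b x≤y)
    where open PreorderProperties E-pre using () renaming (≤-trans to ≤E-trans)

-- LinkM/GapM (t = mc, o = lc) and LinkL/GapL (t = lc, o = mc) at once.
module Parallel {m n K L : ℕ} (t : Fin K → Coll m n) (o : Fin L → Coll m n) where

  Link : Rel m n → Fin K → Fin K → Set
  Link R i j = ∃ λ l → (t i ≤[ R ] o l × o l ≤[ R ] t j) ⊎ (t j ≤[ R ] o l × o l ≤[ R ] t i)

  Gap : Rel m n → Fin K → Fin K → Set
  Gap R i j = ∃ λ s → toℕ s ∈⟦ toℕ i , toℕ j ⟧ × t i <[ R ] t s × t j <[ R ] t s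

  Good : Rel m n → Set
  Good R = ∀ i j → (Comparable R (t i) (t j) → Link R i j ⊎ ¬ Gap R i j)
                 × (Link R i j ⊎ ¬ Gap R i j → Comparable R (t i) (t j))

  Link-sym : ∀ R {i j} → Link R i j → Link R j i
  Link-sym R (l , h) = l , swap h

  Gap-sym : ∀ R {i j} → Gap R i j → Gap R j i
  Gap-sym R (s , s∈ , i<s , j<s) = s , ∈⟦⟧-sym s∈ , j<s , i<s

  gap? : ∀ R i j → Dec (Gap R i j)
  gap? R i j = any? λ s → ∈⟦⟧? (toℕ s) (toℕ i) (toℕ j) ×-dec <? R (t i) (t s) ×-dec <? R (t j) (t s)

  module GoodProperties {P : Rel m n} (P-pre : IsPreorder P) (P-good : Good P) where

    open PreorderProperties P-pre

    incomparable⇒gap : ∀ {i j} → ¬ t i ≤[ P ] t j → ¬ t j ≤[ P ] t i → Gap P i j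
    incomparable⇒gap {i} {j} i≰j j≰i =
      decidable-stable (gap? P i j) λ no-gap → [ i≰j , j≰i ] (proj₂ (P-good i j) (inj₂ no-gap))

    gap-above : ∀ {i j s} → t i ≤[ P ] t j → toℕ s ∈⟦ toℕ i , toℕ j ⟧ → ¬ t s ≤[ P ] t j → Gap P i j
    gap-above {i} {j} {s} i≤j s∈ s≰j with T? (P (t j) (t s))
    ... | yes j≤s = s , s∈ , ≤-<-trans i≤j (j≤s , s≰j) , (j≤s , s≰j)
    ... | no j≰s with incomparable⇒gap j≰s s≰j
    ...   | s′ , s′∈ , j<s′ , _ = s′ , ∈⟦⟧-subinterval s′∈ s∈ , ≤-<-trans i≤j j<s′ , j<s′

    no-link⇒no-gap : ∀ {i j} → t i <[ P ] t j → (∀ l → t i ≤[ P ] o l → o l ≤[ P ] t j → ⊥) → ¬ Gap P i j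
    no-link⇒no-gap {i} {j} (i≤j , j≰i) no-link with proj₁ (P-good i j) (inj₁ i≤j)
    ... | inj₁ (l , inj₁ (i≤l , l≤j)) = ⊥-elim (no-link l i≤l l≤j)
    ... | inj₁ (l , inj₂ (j≤l , l≤i)) = ⊥-elim (j≰i (≤-trans j≤l l≤i))
    ... | inj₂ no-gap = no-gap

    module Refinement {E : Rel m n} (E-pre : IsPreorder E) (P⊑E : P ⊑ E) where

      open PreorderProperties E-pre using () renaming (≤-trans to ≤E-trans)

      gap-reflect : ∀ {i j} → t i ≤[ P ] t j → Gap E i j → Gap P i j
      gap-reflect i≤j (s , s∈ , _ , (_ , s≰j)) = gap-above i≤j s∈ (s≰j ∘ P⊑E _ _)

      gap-lift : ∀ {i j} → ¬ t i ≤[ E ] t j → ¬ t j ≤[ E ] t i → Gap E i j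
      gap-lift {i} {j} i≰j j≰i with incomparable⇒gap (i≰j ∘ P⊑E _ _) (j≰i ∘ P⊑E _ _)
      ... | s , s∈ , (i≤s , _) , (j≤s , _) =
        s , s∈ , (P⊑E _ _ i≤s , j≰i ∘ ≤E-trans (P⊑E _ _ j≤s))
              , (P⊑E _ _ j≤s , i≰j ∘ ≤E-trans (P⊑E _ _ i≤s))

      good-refinement : (∀ i j → ¬ t i ≤[ P ] t j → ¬ t j ≤[ P ] t i → t i ≤[ E ] t j → Link E i j ⊎ ¬ Gap E i j)
                        → Good E
      good-refinement new i j = comparable⇒ , ⇒comparable
        where
        old : Comparable P (t i) (t j) → Link E i j ⊎ ¬ Gap E i j
        old c with proj₁ (P-good i j) c
        ... | inj₁ (l , h) = inj₁ (l , Sum.map (Product.map (P⊑E _ _) (P⊑E _ _))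
                                             (Product.map (P⊑E _ _) (P⊑E _ _)) h)
        ... | inj₂ no-gap = inj₂ λ gap →
          no-gap ([ (λ i≤j → gap-reflect i≤j gap) , (λ j≤i → Gap-sym P (gap-reflect j≤i (Gap-sym E gap))) ] c)

        comparable⇒ : Comparable E (t i) (t j) → Link E i j ⊎ ¬ Gap E i j
        comparable⇒ c with comparable? P (t i) (t j)
        ... | yes c′ = old c′
        ... | no inc = [ new i j (inc ∘ inj₁) (inc ∘ inj₂)
                       , Sum.map (Link-sym E) (λ no-gap → no-gap ∘ Gap-sym E) ∘ new j i (inc ∘ inj₂) (inc ∘ inj₁) ] c

        ⇒comparable : Link E i j ⊎ ¬ Gap E i j → Comparable E (t i) (t j)
        ⇒comparable (inj₁ (l , inj₁ (i≤l , l≤j))) = inj₁ (≤E-trans i≤l l≤j)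
        ⇒comparable (inj₁ (l , inj₂ (j≤l , l≤i))) = inj₂ (≤E-trans j≤l l≤i)
        ⇒comparable (inj₂ no-gap) with comparable? E (t i) (t j)
        ... | yes c = c
        ... | no inc = ⊥-elim (no-gap (gap-lift (inc ∘ inj₁) (inc ∘ inj₂)))

module VertexOrder {m n : ℕ} {P : Rel m n} (P-pre : IsPreorder P)
                   (P-antisym : ∀ {x y} → x ≤[ P ] y → y ≤[ P ] x → x ≡ y) where

  open PreorderProperties P-pre
  open Contraction P-pre

  module Cover {a b : Coll m n} (a⋖b : Covers P a b) where

    a≤b : a ≤[ P ] b
    a≤b = proj₁ (proj₁ a⋖b)

    b≰a : ¬ b ≤[ P ] a
    b≰a = proj₂ (proj₁ a⋖b)

    interval : ∀ {z} → a ≤[ P ] z → z ≤[ P ] b → z ≡ a ⊎ z ≡ b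
    interval {z} a≤z z≤b with T? (P z a) | T? (P b z)
    ... | yes z≤a | _ = inj₁ (P-antisym z≤a a≤z)
    ... | no _ | yes b≤z = inj₂ (P-antisym z≤b b≤z)
    ... | no z≰a | no b≰z = ⊥-elim (proj₂ a⋖b (z , (a≤z , z≰a) , (z≤b , b≰z)))

    contract-identifies : a ≈[ contract P a b ] b
    contract-identifies = P⊑contract a b a≤b , contract-intro (≤-refl b) (≤-refl a)

    contract-endpoints : ∀ {a′ b′} → (∀ x y → contract P a b x y ≡ contract P a′ b′ x y) → b ≤[ P ] b′ × a′ ≤[ P ] a
    contract-endpoints {a′} {b′} same =
      [ ⊥-elim ∘ b≰a , id ] (contract-elim a′ b′ (subst T (same b a) (proj₂ contract-identifies)))

    contract-only-identifies : OnlyIdentifies (contract P a b) a b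
    contract-only-identifies x y (x≤y , y≤x) with contract-elim a b x≤y | contract-elim a b y≤x
    ... | inj₁ x≤y | inj₁ y≤x = inj₁ (P-antisym x≤y y≤x)
    ... | inj₁ x≤y | inj₂ (y≤b , a≤x) =
      pair-classes (interval a≤x (≤-trans x≤y y≤b)) (interval (≤-trans a≤x x≤y) y≤b)
    ... | inj₂ (x≤b , a≤y) | inj₁ y≤x =
      pair-classes (interval (≤-trans a≤y y≤x) x≤b) (interval a≤y (≤-trans y≤x x≤b))
    ... | inj₂ (x≤b , a≤y) | inj₂ (y≤b , a≤x) = pair-classes (interval a≤x x≤b) (interval a≤y y≤b)

  module EdgeOver {E : Rel m n} (E-pre : IsPreorder E) (P⊑E : P ⊑ E)
                  {a b : Coll m n} (a<b : a <[ P ] b) (a≈b : a ≈[ E ] b) (only : OnlyIdentifies E a b) where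

    open PreorderProperties E-pre using () renaming (≤-trans to ≤E-trans)

    edge-cover : Covers P a b
    edge-cover = a<b , λ { (c , (a≤c , c≰a) , (c≤b , b≰c)) →
      [ c≰a ∘ ≤-reflexive , b≰c ∘ ≤-reflexive ∘ sym ]
        (OnlyIdentifies-endpoint only (inj₁ refl) (≤E-trans (P⊑E _ _ c≤b) (proj₂ a≈b) , P⊑E _ _ a≤c)) }

    identified⇒contract : ∀ {x y} → x ≈[ E ] y → x ≤[ contract P a b ] y
    identified⇒contract {x} {y} x≈y with only x y x≈y
    ... | inj₁ refl = P⊑contract x x (≤-refl x)
    ... | inj₂ (inj₁ (refl , refl)) = P⊑contract a b (proj₁ a<b)
    ... | inj₂ (inj₂ (refl , refl)) = contract-intro (≤-refl b) (≤-refl a)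

    comparable⇒contract : ∀ {x y} → Comparable P x y → x ≤[ E ] y → x ≤[ contract P a b ] y
    comparable⇒contract (inj₁ x≤y) _ = P⊑contract _ _ x≤y
    comparable⇒contract (inj₂ y≤x) x≤Ey = identified⇒contract (x≤Ey , P⊑E _ _ y≤x)

    contract⊑edge : contract P a b ⊑ E
    contract⊑edge = contract-least E-pre P⊑E (proj₂ a≈b)

  module ParallelFamily {K L : ℕ} (t : Fin K → Coll m n) (o : Fin L → Coll m n)
                        (t-injective : ∀ {i j} → t i ≡ t j → i ≡ j)
                        (t≢o : ∀ i l → t i ≢ o l)
                        (t-or-o : ∀ x → (∃ λ i → x ≡ t i) ⊎ (∃ λ l → x ≡ o l))
                        (orthogonal : ∀ i l → Comparable P (t i) (o l))
                        (P-good : Parallel.Good t o P) where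

    open Parallel t o
    open GoodProperties P-pre P-good

    module ParallelCover {ia ib : Fin K} (a⋖b : Covers P (t ia) (t ib)) where

      open Cover a⋖b

      no-orthogonal-inside : ∀ l → t ia ≤[ P ] o l → o l ≤[ P ] t ib → ⊥
      no-orthogonal-inside l a≤l l≤b = [ t≢o ia l ∘ sym , t≢o ib l ∘ sym ] (interval a≤l l≤b)

      no-gap : ¬ Gap P ia ib
      no-gap = no-link⇒no-gap (a≤b , b≰a) no-orthogonal-inside

      -- If t j ≢ t ia then t j ∥ t ib, and their P-gap would lie between ia and j or between ia and ib, where P has none.
      above-bottom-forced : ∀ {i j} → t i ≤[ P ] t ib → t ia ≤[ P ] t j → ¬ t i ≤[ P ] t j → j ≡ ia
      above-bottom-forced {i} {j} x≤b a≤y x≰y with T? (P (t j) (t ia))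
      ... | yes y≤a = t-injective (P-antisym y≤a a≤y)
      ... | no y≰a = ⊥-elim (absurd (incomparable⇒gap y≰b b≰y))
        where
        b≰y : ¬ t ib ≤[ P ] t j
        b≰y = x≰y ∘ ≤-trans x≤b

        y≰b : ¬ t j ≤[ P ] t ib
        y≰b y≤b = [ y≰a ∘ ≤-reflexive , b≰y ∘ ≤-reflexive ∘ sym ] (interval a≤y y≤b)

        no-gap-ay : ¬ Gap P ia j
        no-gap-ay = no-link⇒no-gap (a≤y , y≰a) λ l a≤l l≤y →
          [ (λ b≤l → x≰y (≤-trans x≤b (≤-trans b≤l l≤y))) , no-orthogonal-inside l a≤l ] (orthogonal ib l)

        absurd : Gap P j ib → ⊥
        absurd (s , s∈ , (_ , s≰y) , (_ , s≰b)) =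
          [ (λ s∈ya → no-gap-ay (gap-above a≤y (∈⟦⟧-sym s∈ya) s≰y))
          , (λ s∈ab → no-gap (gap-above a≤b s∈ab s≰b)) ] (∈⟦⟧-split (toℕ ia) s∈)

      no-gap-below : ∀ {i} → t i ≤[ P ] t ib → ¬ t i ≤[ P ] t ia → ¬ t ia ≤[ P ] t i →
                     ¬ Gap (contract P (t ia) (t ib)) i ia
      no-gap-below {i} x≤b x≰a a≰x (s , s∈ , _ , (_ , s≰Ca)) =
        [ (λ s∈xb → no-gap-xb (gap-above x≤b s∈xb s≰b))
        , (λ s∈ba → no-gap (gap-above a≤b (∈⟦⟧-sym s∈ba) s≰b)) ] (∈⟦⟧-split (toℕ ib) s∈)
        where
        s≰b : ¬ t s ≤[ P ] t ib
        s≰b s≤b = s≰Ca (contract-intro s≤b (≤-refl (t ia)))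

        no-gap-xb : ¬ Gap P i ib
        no-gap-xb = no-link⇒no-gap (x≤b , a≰x ∘ ≤-trans a≤b) λ l x≤l l≤b →
          [ (λ a≤l → no-orthogonal-inside l a≤l l≤b) , (λ l≤a → x≰a (≤-trans x≤l l≤a)) ] (orthogonal ia l)

    newly-comparable : ∀ {a b} → Covers P a b → ∀ i j → ¬ t i ≤[ P ] t j → ¬ t j ≤[ P ] t i →
                       t i ≤[ contract P a b ] t j → Link (contract P a b) i j ⊎ ¬ Gap (contract P a b) i j
    newly-comparable {a} {b} a⋖b i j i≰j j≰i i≤Cj with contract-elim a b i≤Cj
    ... | inj₁ i≤j = ⊥-elim (i≰j i≤j)
    ... | inj₂ (i≤b , a≤j) with t-or-o a | t-or-o b
    ...   | inj₂ (l , refl) | _ = inj₁ (l , inj₁ (contract-intro i≤b (≤-refl (o l)) , P⊑contract _ _ a≤j))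
    ...   | inj₁ _ | inj₂ (l , refl) = inj₁ (l , inj₁ (P⊑contract _ _ i≤b , contract-intro (≤-refl (o l)) a≤j))
    ...   | inj₁ (ia , refl) | inj₁ (ib , refl) with ParallelCover.above-bottom-forced a⋖b i≤b a≤j i≰j
    ...     | refl = inj₂ (ParallelCover.no-gap-below a⋖b i≤b i≰j j≰i)

    contract-good : ∀ {a b} → Covers P a b → Good (contract P a b)
    contract-good {a} {b} a⋖b =
      Refinement.good-refinement (contract-isPreorder a b) P⊑contract (newly-comparable a⋖b)

    module EdgeRefinement {E : Rel m n} (E-pre : IsPreorder E) (E-good : Good E) (P⊑E : P ⊑ E) where

      open PreorderProperties E-pre using () renaming (≤-trans to ≤E-trans)

      identified-comparable : ∀ {i j} → OnlyIdentifies E (t i) (t j) → t i ≈[ E ] t j → Comparable P (t i) (t j)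
      identified-comparable {i} {j} only (i≤Ej , j≤Ei) with comparable? P (t i) (t j)
      ... | yes c = c
      ... | no inc = ⊥-elim (absurd (incomparable⇒gap (inc ∘ inj₁) (inc ∘ inj₂)) (proj₁ (E-good i j) (inj₁ i≤Ej)))
        where
        orthogonal-not-identified : ∀ l → o l ≤[ E ] t i → t i ≤[ E ] o l → ⊥
        orthogonal-not-identified l l≤i i≤l =
          [ t≢o i l ∘ sym , t≢o j l ∘ sym ] (OnlyIdentifies-endpoint only (inj₁ refl) (l≤i , i≤l))

        absurd : Gap P i j → Link E i j ⊎ ¬ Gap E i j → ⊥
        absurd _ (inj₁ (l , inj₁ (i≤l , l≤j))) = orthogonal-not-identified l (≤E-trans l≤j j≤Ei) i≤l
        absurd _ (inj₁ (l , inj₂ (j≤l , l≤i))) = orthogonal-not-identified l l≤i (≤E-trans i≤Ej j≤l)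
        absurd (s , s∈ , (i≤s , s≰i) , (j≤s , s≰j)) (inj₂ no-gap) =
          no-gap (s , s∈ , (P⊑E _ _ i≤s , s≰E (inj₁ refl) i≤s) , (P⊑E _ _ j≤s , s≰E (inj₂ refl) j≤s))
          where
          s≰E : ∀ {w} → w ≡ t i ⊎ w ≡ t j → w ≤[ P ] t s → ¬ t s ≤[ E ] w
          s≰E w∈ w≤s s≤w =
            [ s≰i ∘ ≤-reflexive , s≰j ∘ ≤-reflexive ] (OnlyIdentifies-endpoint only w∈ (s≤w , P⊑E _ _ w≤s))

      module _ {a b : Coll m n} (a<b : a <[ P ] b) (a≈b : a ≈[ E ] b) (only : OnlyIdentifies E a b) where

        open EdgeOver E-pre P⊑E a<b a≈b only

        incomparable⇒contract : ∀ {i j} → t i ≤[ E ] t j → ¬ t j ≤[ E ] t i →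
                                ¬ t i ≤[ P ] t j → ¬ t j ≤[ P ] t i → t i ≤[ contract P a b ] t j
        incomparable⇒contract {i} {j} i≤Ej j≰Ei i≰j j≰i with T? (contract P a b (t i) (t j))
        ... | yes i≤Cj = i≤Cj
        ... | no i≰Cj = ⊥-elim (absurd (incomparable⇒gap i≰j j≰i) (proj₁ (E-good i j) (inj₁ i≤Ej)))
          where
          open PreorderProperties (contract-isPreorder a b) using () renaming (≤-trans to ≤C-trans)

          absurd : Gap P i j → Link E i j ⊎ ¬ Gap E i j → ⊥
          absurd _ (inj₁ (l , inj₁ (i≤l , l≤j))) =
            i≰Cj (≤C-trans (comparable⇒contract (orthogonal i l) i≤l)
                           (comparable⇒contract (swap (orthogonal j l)) l≤j))
          absurd _ (inj₁ (l , inj₂ (j≤l , l≤i))) = j≰Ei (≤E-trans j≤l l≤i)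
          absurd (s , s∈ , (i≤s , _) , (j≤s , s≰j)) (inj₂ no-gap) =
            no-gap (s , s∈ , (P⊑E _ _ i≤s , j≰Ei ∘ ≤E-trans (P⊑E _ _ j≤s)) , (P⊑E _ _ j≤s , s≰Ej))
            where
            s≰Ej : ¬ t s ≤[ E ] t j
            s≰Ej s≤j with only (t s) (t j) (s≤j , P⊑E _ _ j≤s)
            ... | inj₁ s≡j = s≰j (≤-reflexive s≡j)
            ... | inj₂ (inj₁ (s≡a , j≡b)) =
              proj₂ a<b (≤-trans (≤-reflexive (sym j≡b)) (≤-trans j≤s (≤-reflexive s≡a)))
            ... | inj₂ (inj₂ (s≡b , j≡a)) =
              i≰Cj (contract-intro (≤-trans i≤s (≤-reflexive s≡b)) (≤-reflexive (sym j≡a)))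

module CoverEdgeCorrespondence {m n : ℕ} {P : Rel m n} (V : IsVertex P) where

  P-pre : IsPreorder P
  P-pre = proj₁ (proj₁ V)

  P-antisym : ∀ {x y} → x ≤[ P ] y → y ≤[ P ] x → x ≡ y
  P-antisym x≤y y≤x = proj₂ V _ _ (x≤y , y≤x)

  P-orthogonal : ∀ i j → Comparable P (mc i) (lc j)
  P-orthogonal = proj₁ (proj₂ (proj₁ V))

  open PreorderProperties P-pre
  open Contraction P-pre
  open VertexOrder P-pre P-antisym

  mc-injective : ∀ {i j} → mc {m} {n} i ≡ mc j → i ≡ j
  mc-injective refl = refl

  lc-injective : ∀ {i j} → lc {m} {n} i ≡ lc j → i ≡ j
  lc-injective refl = refl

  mc-or-lc : ∀ (x : Coll m n) → (∃ λ i → x ≡ mc i) ⊎ (∃ λ l → x ≡ lc l)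
  mc-or-lc (mc i) = inj₁ (i , refl)
  mc-or-lc (lc l) = inj₂ (l , refl)

  module M = ParallelFamily mc lc mc-injective (λ _ _ ()) mc-or-lc P-orthogonal (proj₁ (proj₂ (proj₂ (proj₁ V))))
  module L = ParallelFamily lc mc lc-injective (λ _ _ ()) (swap ∘ mc-or-lc) (λ i j → swap (P-orthogonal j i))
                            (proj₂ (proj₂ (proj₂ (proj₁ V))))

  contract-isEdge : ∀ {a b} → Covers P a b → IsEdge (contract P a b)
  contract-isEdge {a} {b} a⋖b =
    ( ( contract-isPreorder a b
      , (λ i j → Sum.map (P⊑contract _ _) (P⊑contract _ _) (P-orthogonal i j))
      , M.contract-good a⋖b
      , L.contract-good a⋖b )
    , a , b , b≰a ∘ ≤-reflexive ∘ sym , contract-identifies , contract-only-identifies )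
    where open Cover a⋖b

  open Setoid (CoverSetoid P) using () renaming (Carrier to CoverPair; _≈_ to _≈ᶜ_)
  open Setoid (EdgeAboveSetoid P) using () renaming (Carrier to EdgePreorder; _≈_ to _≈ᵉ_)

  to-edge : CoverPair → EdgePreorder
  to-edge ((a , b) , a⋖b) = contract P a b , contract-isEdge a⋖b , P⊑contract

  to-edge-cong : Congruent _≈ᶜ_ _≈ᵉ_ to-edge
  to-edge-cong eq x y = cong (λ (a , b) → contract P a b x y) eq

  to-edge-injective : Injective _≈ᶜ_ _≈ᵉ_ to-edge
  to-edge-injective {(a , b) , a⋖b} {(a′ , b′) , a′⋖b′} same =
    let b≤b′ , a′≤a = Cover.contract-endpoints a⋖b same
        b′≤b , a≤a′ = Cover.contract-endpoints a′⋖b′ (λ x y → sym (same x y))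
    in cong₂ _,_ (P-antisym a≤a′ a′≤a) (P-antisym b≤b′ b′≤b)

  module GoodEdgeOver {E : Rel m n} (E-rect : IsGoodRect E) (P⊑E : P ⊑ E) where

    E-pre : IsPreorder E
    E-pre = proj₁ E-rect

    module ME = M.EdgeRefinement E-pre (proj₁ (proj₂ (proj₂ E-rect))) P⊑E
    module LE = L.EdgeRefinement E-pre (proj₂ (proj₂ (proj₂ E-rect))) P⊑E

    identified-comparable : ∀ {a b} → OnlyIdentifies E a b → a ≈[ E ] b → Comparable P a b
    identified-comparable {mc i} {mc j} = ME.identified-comparable
    identified-comparable {lc i} {lc j} = LE.identified-comparable
    identified-comparable {mc i} {lc j} _ _ = P-orthogonal i j
    identified-comparable {lc i} {mc j} _ _ = swap (P-orthogonal j i)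

    module _ {a b : Coll m n} (a<b : a <[ P ] b) (a≈b : a ≈[ E ] b) (only : OnlyIdentifies E a b) where

      open EdgeOver E-pre P⊑E a<b a≈b only public

      incomparable⇒contract : ∀ x y → x ≤[ E ] y → ¬ y ≤[ E ] x → ¬ x ≤[ P ] y → ¬ y ≤[ P ] x →
                              x ≤[ contract P a b ] y
      incomparable⇒contract (mc i) (mc j) = ME.incomparable⇒contract a<b a≈b only
      incomparable⇒contract (lc i) (lc j) = LE.incomparable⇒contract a<b a≈b only
      incomparable⇒contract (mc i) (lc j) _ _ i≰j j≰i = ⊥-elim ([ i≰j , j≰i ] (P-orthogonal i j))
      incomparable⇒contract (lc i) (mc j) _ _ i≰j j≰i = ⊥-elim ([ j≰i , i≰j ] (P-orthogonal j i))

      edge⊑contract : E ⊑ contract P a b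
      edge⊑contract x y x≤y with comparable? P x y | T? (E y x)
      ... | yes c | _ = comparable⇒contract c x≤y
      ... | no _ | yes y≤x = identified⇒contract (x≤y , y≤x)
      ... | no inc | no y≰x = incomparable⇒contract x y x≤y y≰x (inc ∘ inj₁) (inc ∘ inj₂)

      edge-is-contract : ∀ x y → contract P a b x y ≡ E x y
      edge-is-contract x y = T-⇔⇒≡ (contract⊑edge x y) (edge⊑contract x y)

    preimage : ∀ {a b} → a ≢ b → a ≈[ E ] b → OnlyIdentifies E a b → a ≤[ P ] b →
               ∃ λ (c : CoverPair) → ∀ x y → proj₁ (to-edge c) x y ≡ E x y
    preimage a≢b a≈b only a≤b = (_ , edge-cover a<b a≈b only) , edge-is-contract a<b a≈b only
      where
      a<b : _ <[ P ] _
      a<b = a≤b , a≢b ∘ P-antisym a≤b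

  to-edge-strictlySurjective : StrictlySurjective _≈ᵉ_ to-edge
  to-edge-strictlySurjective (E , ((E-rect , a , b , a≢b , a≈b , only) , P⊑E)) =
    [ preimage a≢b a≈b only , preimage (a≢b ∘ sym) (Product.swap a≈b) (OnlyIdentifies-sym only) ]′
      (identified-comparable only a≈b)
    where open GoodEdgeOver E-rect P⊑E

  to-edge-bijective : Bijective _≈ᶜ_ _≈ᵉ_ to-edge
  to-edge-bijective =
      (λ {c} {d} → to-edge-injective {c} {d})
    , strictlySurjective⇒surjective {f = to-edge} (λ {c} {d} → to-edge-cong {c} {d}) to-edge-strictlySurjective
    where open Consequences (CoverSetoid P) (EdgeAboveSetoid P)

mainTheorem9 : (m n : ℕ) → 1 ≤ m → 1 ≤ n → (P : Rel m n) → IsVertex P →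
    Bijection (CoverSetoid P) (EdgeAboveSetoid P)
mainTheorem9 m n _ _ P V = record
  { to        = to-edge
  ; cong      = λ {c} {d} → to-edge-cong {c} {d}
  ; bijective = to-edge-bijective
  }
  where open CoverEdgeCorrespondence V
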